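{- For every function $f:\{0,1\}^n\to\{ -1,1\}$, $$\mathbb{E}_{x,y}\sum_{\alpha,\beta\in\{0,1\}^n}\widehat{f_x}^{\,2}(\alpha)\,\widehat{f_y}^{\,2}(\beta)\,\widehat{f_{x+y}}^{\,2}(\alpha+\beta)=\mathbb{E}_y\sum_{\alpha\in\{0,1\}^n}\widehat{f_y}^{\,6}(\alpha),$$ where $x,y$ are independent uniform in $\{0,1\}^n$.
   Context: Addition in $\{0,1\}^n$ is in $\mathbb{F}_2^n$; $f_y(x)=f(x)f(x+y)$; $\hat h(\alpha)=\mathbb{E}_x h(x)(-1)^{\langle\alpha,x\rangle}$ with $\langle\alpha,x\rangle=\sum_i\alpha_ix_i\bmod 2$. -}

module Defs where

open import Data.Bool using (Bool; true; false; _xor_; _∧_)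
open import Data.Nat as ℕ using (ℕ; zero; suc; _^_)
open import Data.Nat.Properties using (m^n≢0)
open import Data.Integer as ℤ using (ℤ; +_)
open import Data.Rational using (ℚ; 0ℚ; 1ℚ; _+_; _*_; -_; _/_)
open import Data.List using (List; []; _∷_; map; foldr; concatMap)
open import Data.Sum using (_⊎_)
open import Relation.Binary.PropositionalEquality using (_≡_)
open import Data.Vec using (Vec; []; _∷_; zipWith)

-- {0,1}^n as Bool vectors; addition in F_2^n is coordinatewise xor
Cube : ℕ → Set
Cube n = Vec Bool n

_⊕_ : ∀ {n} → Cube n → Cube n → Cube n
_⊕_ = zipWith _xor_

allCube : (n : ℕ) → List (Cube n)
allCube zero = [] ∷ []
allCube (suc n) = concatMap (λ v → (false ∷ v) ∷ (true ∷ v) ∷ []) (allCube n)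

inner : ∀ {n} → Cube n → Cube n → Bool
inner [] [] = false
inner (a ∷ α) (b ∷ x) = (a ∧ b) xor inner α x

sgn : Bool → ℚ
sgn false = 1ℚ
sgn true = - 1ℚ

sumℚ : List ℚ → ℚ
sumℚ = foldr _+_ 0ℚ

Σ[cube] : (n : ℕ) → (Cube n → ℚ) → ℚ
Σ[cube] n g = sumℚ (map g (allCube n))

𝔼 : (n : ℕ) → (Cube n → ℚ) → ℚ
𝔼 n g = Σ[cube] n g * ((+ 1) / (2 ^ n)) {{m^n≢0 2 n}}

-- f : {0,1}^n → {-1,1}, modelled as an ℚ-valued function with values ±1
IsBoolean : ∀ {n} → (Cube n → ℚ) → Set
IsBoolean {n} f = (x : Cube n) → (f x ≡ 1ℚ) ⊎ (f x ≡ - 1ℚ)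

deriv : ∀ {n} → (Cube n → ℚ) → Cube n → Cube n → ℚ
deriv f y x = f x * f (x ⊕ y)

fourier : ∀ {n} → (Cube n → ℚ) → Cube n → ℚ
fourier {n} h α = 𝔼 n (λ x → h x * sgn (inner α x))

_^ℚ_ : ℚ → ℕ → ℚ
q ^ℚ zero = 1ℚ
q ^ℚ suc k = q * (q ^ℚ k)

-- Let K x := f_x ⋆ f_x be the autocorrelation of the derivative f_x, so that
-- K x w = 𝔼_u f(u) f(u+x) f(u+w) f(u+w+x) is symmetric in x and w. The convolution theorem gives
-- \hat{f_x}^2 = \widehat{K x}, and Parseval (with its shifted form Σ_β ĝ(β) ĥ(α+β) = \widehat{gh}(α))
-- turns the left-hand side into 𝔼_{x,y,w} K x w · K y w · K (x+y) w and the right-hand side into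
-- 𝔼_{y,w,u} K y w · K y u · K y (w+u). Swapping the arguments of every K in the former yields the
-- latter after renaming and reordering the averages. Nothing uses that f is ±1-valued.

module Submission where

open import Defs
open import Data.Rational using (ℚ; _*_)
open import Relation.Binary.PropositionalEquality using (_≡_)
open import Data.Nat using (ℕ)

open import Algebra.Bundles using (CommutativeRing)
import Algebra.Properties.CommutativeSemigroup as CommSemigroupProperties
open import Data.Bool using (true; false; _xor_; _∧_; not)
open import Data.Bool.Properties
  using (∧-comm; ∧-distribˡ-xor; xor-comm; xor-assoc; xor-identityˡ; xor-same; xor-∧-commutativeRing)
import Data.Integer as ℤ
import Data.Integer.Properties as ℤ
open import Data.List using (List; []; _∷_; map; concatMap)
open import Data.Maybe using (nothing)
open import Data.Nat as ℕ using (zero; suc; _^_; NonZero)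
import Data.Nat.Properties as ℕ
open import Data.Nat.Properties using (m^n≢0)
import Data.Nat.Coprimality as Coprime
open import Data.Rational using (0ℚ; 1ℚ; _+_; _/_; mkℚ)
open import Data.Rational.Properties
  using (+-identityˡ; +-identityʳ; +-comm; +-assoc; *-comm; *-assoc; *-zeroʳ; *-identityˡ; *-identityʳ;
         *-distribˡ-+; *-distribʳ-+; *-inverseʳ;
         normalize-coprime; +-*-commutativeRing)
open import Data.Vec using ([]; _∷_; replicate)
open import Data.Vec.Properties using (zipWith-comm; zipWith-assoc; zipWith-identityˡ)
open import Level using (0ℓ)
open import Relation.Binary.PropositionalEquality
  using (refl; sym; trans; cong; cong₂; module ≡-Reasoning)
open import Tactic.RingSolver using (solve-∀)
open import Tactic.RingSolver.Core.AlmostCommutativeRing using (AlmostCommutativeRing; fromCommutativeRing)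

open ≡-Reasoning
open CommSemigroupProperties (CommutativeRing.+-commutativeSemigroup +-*-commutativeRing)
  using () renaming (interchange to +-interchange)
open CommSemigroupProperties (CommutativeRing.*-commutativeSemigroup +-*-commutativeRing)
  using () renaming (interchange to *-interchange)
open CommSemigroupProperties (CommutativeRing.+-commutativeSemigroup xor-∧-commutativeRing)
  using () renaming (interchange to xor-interchange)

ℚ-ring : AlmostCommutativeRing 0ℓ 0ℓ
ℚ-ring = fromCommutativeRing +-*-commutativeRing (λ _ → nothing)

private variable
  A B : Set
  n : ℕ

-- Σ[cube] n g is definitionally sumOver (allCube n) g.
sumOver : List A → (A → ℚ) → ℚ
sumOver xs g = sumℚ (map g xs)

sumOver-cong : ∀ (xs : List A) {g h : A → ℚ} → (∀ x → g x ≡ h x) → sumOver xs g ≡ sumOver xs h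
sumOver-cong []       g≗h = refl
sumOver-cong (x ∷ xs) g≗h = cong₂ _+_ (g≗h x) (sumOver-cong xs g≗h)

sumOver-zero : ∀ (xs : List A) → sumOver xs (λ _ → 0ℚ) ≡ 0ℚ
sumOver-zero []       = refl
sumOver-zero (x ∷ xs) = trans (+-identityˡ _) (sumOver-zero xs)

sumOver-+ : ∀ (xs : List A) (g h : A → ℚ) →
            sumOver xs (λ x → g x + h x) ≡ sumOver xs g + sumOver xs h
sumOver-+ []       g h = refl
sumOver-+ (x ∷ xs) g h = begin
  (g x + h x) + sumOver xs (λ x → g x + h x)  ≡⟨ cong ((g x + h x) +_) (sumOver-+ xs g h) ⟩
  (g x + h x) + (sumOver xs g + sumOver xs h) ≡⟨ +-interchange (g x) (h x) _ _ ⟩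
  (g x + sumOver xs g) + (h x + sumOver xs h) ∎

sumOver-*ˡ : ∀ (xs : List A) k (g : A → ℚ) → sumOver xs (λ x → k * g x) ≡ k * sumOver xs g
sumOver-*ˡ []       k g = sym (*-zeroʳ k)
sumOver-*ˡ (x ∷ xs) k g =
  trans (cong (k * g x +_) (sumOver-*ˡ xs k g)) (sym (*-distribˡ-+ k (g x) (sumOver xs g)))

sumOver-*ʳ : ∀ (xs : List A) k (g : A → ℚ) → sumOver xs (λ x → g x * k) ≡ sumOver xs g * k
sumOver-*ʳ xs k g = begin
  sumOver xs (λ x → g x * k) ≡⟨ sumOver-cong xs (λ x → *-comm (g x) k) ⟩
  sumOver xs (λ x → k * g x) ≡⟨ sumOver-*ˡ xs k g ⟩
  k * sumOver xs g           ≡⟨ *-comm k _ ⟩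
  sumOver xs g * k           ∎

sumOver-swap : ∀ (xs : List A) (ys : List B) (g : A → B → ℚ) →
               sumOver xs (λ x → sumOver ys (g x)) ≡ sumOver ys (λ y → sumOver xs (λ x → g x y))
sumOver-swap []       ys g = sym (sumOver-zero ys)
sumOver-swap (x ∷ xs) ys g = trans (cong (sumOver ys (g x) +_) (sumOver-swap xs ys g))
  (sym (sumOver-+ ys (g x) (λ y → sumOver xs (λ x′ → g x′ y))))

zeros : (n : ℕ) → Cube n
zeros n = replicate n false

⊕-comm : (u v : Cube n) → u ⊕ v ≡ v ⊕ u
⊕-comm = zipWith-comm xor-comm

⊕-assoc : (u v w : Cube n) → (u ⊕ v) ⊕ w ≡ u ⊕ (v ⊕ w)
⊕-assoc = zipWith-assoc xor-assoc

⊕-identityˡ : (u : Cube n) → zeros n ⊕ u ≡ u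
⊕-identityˡ = zipWith-identityˡ xor-identityˡ

⊕-self : (u : Cube n) → u ⊕ u ≡ zeros n
⊕-self []      = refl
⊕-self (a ∷ u) = cong₂ _∷_ (xor-same a) (⊕-self u)

⊕-cancelʳ : (u v : Cube n) → (u ⊕ v) ⊕ v ≡ u
⊕-cancelʳ u v = begin
  (u ⊕ v) ⊕ v  ≡⟨ ⊕-assoc u v v ⟩
  u ⊕ (v ⊕ v)  ≡⟨ cong (u ⊕_) (⊕-self v) ⟩
  u ⊕ zeros _  ≡⟨ ⊕-comm u _ ⟩
  zeros _ ⊕ u  ≡⟨ ⊕-identityˡ u ⟩
  u            ∎

Σ[cube]-suc : ∀ n (h : Cube (suc n) → ℚ) →
              Σ[cube] (suc n) h ≡ Σ[cube] n (λ v → h (false ∷ v) + h (true ∷ v))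
Σ[cube]-suc n h = go (allCube n)
  where
  go : ∀ vs → sumOver (concatMap (λ v → (false ∷ v) ∷ (true ∷ v) ∷ []) vs) h
              ≡ sumOver vs (λ v → h (false ∷ v) + h (true ∷ v))
  go []       = refl
  go (v ∷ vs) = trans (cong (λ r → h (false ∷ v) + (h (true ∷ v) + r)) (go vs))
                      (sym (+-assoc (h (false ∷ v)) (h (true ∷ v)) _))

Σ[cube]-translate : ∀ n (a : Cube n) (g : Cube n → ℚ) → Σ[cube] n (λ w → g (w ⊕ a)) ≡ Σ[cube] n g
Σ[cube]-translate zero    []      g = refl
Σ[cube]-translate (suc n) (b ∷ a) g = begin
  Σ[cube] (suc n) (λ w → g (w ⊕ (b ∷ a)))
    ≡⟨ Σ[cube]-suc n _ ⟩
  Σ[cube] n (λ v → g (b ∷ (v ⊕ a)) + g (not b ∷ (v ⊕ a)))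
    ≡⟨ sumOver-cong (allCube n) (λ v → pair-comm b (v ⊕ a)) ⟩
  Σ[cube] n (λ v → g (false ∷ (v ⊕ a)) + g (true ∷ (v ⊕ a)))
    ≡⟨ Σ[cube]-translate n a (λ v → g (false ∷ v) + g (true ∷ v)) ⟩
  Σ[cube] n (λ v → g (false ∷ v) + g (true ∷ v))
    ≡⟨ sym (Σ[cube]-suc n g) ⟩
  Σ[cube] (suc n) g ∎
  where
  pair-comm : ∀ b v → g (b ∷ v) + g (not b ∷ v) ≡ g (false ∷ v) + g (true ∷ v)
  pair-comm false v = refl
  pair-comm true  v = +-comm (g (true ∷ v)) (g (false ∷ v))

m/1≡mkℚ : ∀ m → ℤ.+ m / 1 ≡ mkℚ (ℤ.+ m) 0 (Coprime.sym (Coprime.1-coprimeTo m))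
m/1≡mkℚ m = normalize-coprime (Coprime.sym (Coprime.1-coprimeTo m))

m/1+n/1≡[m+n]/1 : ∀ m n → ℤ.+ m / 1 + ℤ.+ n / 1 ≡ ℤ.+ (m ℕ.+ n) / 1
m/1+n/1≡[m+n]/1 m n = begin
  ℤ.+ m / 1 + ℤ.+ n / 1
    ≡⟨ cong₂ _+_ (m/1≡mkℚ m) (m/1≡mkℚ n) ⟩
  (ℤ.+ m ℤ.* ℤ.+ 1 ℤ.+ ℤ.+ n ℤ.* ℤ.+ 1) / 1
    ≡⟨ cong (_/ 1) (cong₂ ℤ._+_ (ℤ.*-identityʳ (ℤ.+ m)) (ℤ.*-identityʳ (ℤ.+ n))) ⟩
  ℤ.+ (m ℕ.+ n) / 1 ∎

m/1*1/m≡1 : ∀ m .{{_ : NonZero m}} → (ℤ.+ m / 1) * (ℤ.+ 1 / m) ≡ 1ℚ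
m/1*1/m≡1 m@(suc _) = trans
  (cong₂ _*_ (m/1≡mkℚ m) (normalize-coprime (Coprime.1-coprimeTo m)))
  (*-inverseʳ (mkℚ (ℤ.+ m) 0 (Coprime.sym (Coprime.1-coprimeTo m))))

Σ[cube]-const : ∀ n k → Σ[cube] n (λ _ → k) ≡ k * (ℤ.+ (2 ^ n) / 1)
Σ[cube]-const zero    k = trans (+-identityʳ k) (sym (*-identityʳ k))
Σ[cube]-const (suc n) k = begin
  Σ[cube] (suc n) (λ _ → k)
    ≡⟨ Σ[cube]-suc n _ ⟩
  Σ[cube] n (λ _ → k + k)
    ≡⟨ sumOver-+ (allCube n) _ _ ⟩
  Σ[cube] n (λ _ → k) + Σ[cube] n (λ _ → k)
    ≡⟨ cong₂ _+_ (Σ[cube]-const n k) (Σ[cube]-const n k) ⟩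
  k * (ℤ.+ (2 ^ n) / 1) + k * (ℤ.+ (2 ^ n) / 1)
    ≡⟨ sym (*-distribˡ-+ k _ _) ⟩
  k * (ℤ.+ (2 ^ n) / 1 + ℤ.+ (2 ^ n) / 1)
    ≡⟨ cong (k *_) (m/1+n/1≡[m+n]/1 (2 ^ n) (2 ^ n)) ⟩
  k * (ℤ.+ (2 ^ n ℕ.+ 2 ^ n) / 1)
    ≡⟨ cong (λ m → k * (ℤ.+ (2 ^ n ℕ.+ m) / 1)) (sym (ℕ.+-identityʳ (2 ^ n))) ⟩
  k * (ℤ.+ (2 ^ suc n) / 1) ∎

𝔼-const : ∀ n k → 𝔼 n (λ _ → k) ≡ k
𝔼-const n k = begin
  Σ[cube] n (λ _ → k) * (ℤ.+ 1 / 2 ^ n)           ≡⟨ cong (_* _) (Σ[cube]-const n k) ⟩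
  k * (ℤ.+ (2 ^ n) / 1) * (ℤ.+ 1 / 2 ^ n)         ≡⟨ *-assoc k _ _ ⟩
  k * ((ℤ.+ (2 ^ n) / 1) * (ℤ.+ 1 / 2 ^ n))       ≡⟨ cong (k *_) (m/1*1/m≡1 (2 ^ n)) ⟩
  k * 1ℚ                                           ≡⟨ *-identityʳ k ⟩
  k                                                ∎
  where instance _ = m^n≢0 2 n

𝔼-cong : {g h : Cube n → ℚ} → (∀ x → g x ≡ h x) → 𝔼 n g ≡ 𝔼 n h
𝔼-cong {n} g≗h = cong (_* _) (sumOver-cong (allCube n) g≗h)

𝔼-*ˡ : ∀ k (g : Cube n → ℚ) → 𝔼 n (λ x → k * g x) ≡ k * 𝔼 n g
𝔼-*ˡ {n} k g = trans (cong (_* _) (sumOver-*ˡ (allCube n) k g)) (*-assoc k _ _)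

𝔼-*ʳ : ∀ k (g : Cube n → ℚ) → 𝔼 n (λ x → g x * k) ≡ 𝔼 n g * k
𝔼-*ʳ {n} k g = begin
  𝔼 n (λ x → g x * k) ≡⟨ 𝔼-cong (λ x → *-comm (g x) k) ⟩
  𝔼 n (λ x → k * g x) ≡⟨ 𝔼-*ˡ k g ⟩
  k * 𝔼 n g           ≡⟨ *-comm k _ ⟩
  𝔼 n g * k           ∎

𝔼-translate : ∀ (a : Cube n) (g : Cube n → ℚ) → 𝔼 n (λ w → g (w ⊕ a)) ≡ 𝔼 n g
𝔼-translate {n} a g = cong (_* _) (Σ[cube]-translate n a g)

Σ[cube]-𝔼-comm : ∀ m (g : Cube m → Cube n → ℚ) →
                 Σ[cube] m (λ α → 𝔼 n (g α)) ≡ 𝔼 n (λ x → Σ[cube] m (λ α → g α x))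
Σ[cube]-𝔼-comm {n} m g =
  trans (sumOver-*ʳ (allCube m) _ _) (cong (_* _) (sumOver-swap (allCube m) (allCube n) g))

𝔼-swap : ∀ (g : Cube n → Cube n → ℚ) → 𝔼 n (λ x → 𝔼 n (g x)) ≡ 𝔼 n (λ y → 𝔼 n (λ x → g x y))
𝔼-swap {n} g =
  cong (_* _) (trans (Σ[cube]-𝔼-comm n g) (sym (sumOver-*ʳ (allCube n) _ _)))

𝔼-product : ∀ (g h : Cube n → ℚ) → 𝔼 n g * 𝔼 n h ≡ 𝔼 n (λ x → 𝔼 n (λ y → g x * h y))
𝔼-product {n} g h = begin
  𝔼 n g * 𝔼 n h                        ≡⟨ sym (𝔼-*ʳ (𝔼 n h) g) ⟩
  𝔼 n (λ x → g x * 𝔼 n h)              ≡⟨ 𝔼-cong (λ x → sym (𝔼-*ˡ (g x) h)) ⟩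
  𝔼 n (λ x → 𝔼 n (λ y → g x * h y))    ∎

χ : Cube n → Cube n → ℚ
χ α x = sgn (inner α x)

sgn-xor : ∀ a b → sgn (a xor b) ≡ sgn a * sgn b
sgn-xor false b    = sym (*-identityˡ (sgn b))
sgn-xor true false = refl
sgn-xor true true  = refl

sgn-square : ∀ b → sgn b * sgn b ≡ 1ℚ
sgn-square false = refl
sgn-square true  = refl

sgn-not : ∀ b → sgn b + sgn (not b) ≡ 0ℚ
sgn-not false = refl
sgn-not true  = refl

inner-comm : (α x : Cube n) → inner α x ≡ inner x α
inner-comm []      []      = refl
inner-comm (a ∷ α) (b ∷ x) = cong₂ _xor_ (∧-comm a b) (inner-comm α x)

inner-⊕ʳ : (α u w : Cube n) → inner α (u ⊕ w) ≡ inner α u xor inner α w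
inner-⊕ʳ []      []      []      = refl
inner-⊕ʳ (a ∷ α) (b ∷ u) (c ∷ w) = trans
  (cong₂ _xor_ (∧-distribˡ-xor a b c) (inner-⊕ʳ α u w))
  (xor-interchange (a ∧ b) (a ∧ c) (inner α u) (inner α w))

χ-comm : (α x : Cube n) → χ α x ≡ χ x α
χ-comm α x = cong sgn (inner-comm α x)

χ-⊕ʳ : (α u w : Cube n) → χ α (u ⊕ w) ≡ χ α u * χ α w
χ-⊕ʳ α u w = trans (cong sgn (inner-⊕ʳ α u w)) (sgn-xor (inner α u) (inner α w))

χ-⊕ˡ : (α β x : Cube n) → χ (α ⊕ β) x ≡ χ α x * χ β x
χ-⊕ˡ α β x = begin
  χ (α ⊕ β) x     ≡⟨ χ-comm (α ⊕ β) x ⟩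
  χ x (α ⊕ β)     ≡⟨ χ-⊕ʳ x α β ⟩
  χ x α * χ x β   ≡⟨ cong₂ _*_ (χ-comm x α) (χ-comm x β) ⟩
  χ α x * χ β x   ∎

-- Orthogonality of characters: Σ_α χ α w is 2^n at w = 0 and vanishes elsewhere.
Σ[cube]-χ-sift : ∀ n (g : Cube n → ℚ) →
                 Σ[cube] n (λ w → g w * Σ[cube] n (λ α → χ α w)) ≡ Σ[cube] n (λ _ → g (zeros n))
Σ[cube]-χ-sift zero    g = cong (_+ 0ℚ) (*-identityʳ (g []))
Σ[cube]-χ-sift (suc n) g = begin
  Σ[cube] (suc n) (λ w → g w * X (suc n) w)
    ≡⟨ Σ[cube]-suc n _ ⟩
  Σ[cube] n (λ v → g (false ∷ v) * X (suc n) (false ∷ v) + g (true ∷ v) * X (suc n) (true ∷ v))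
    ≡⟨ sumOver-cong (allCube n) (λ v →
         cong₂ (λ p q → g (false ∷ v) * p + g (true ∷ v) * q) (X-false v) (X-true v)) ⟩
  Σ[cube] n (λ v → g (false ∷ v) * (X n v + X n v) + g (true ∷ v) * 0ℚ)
    ≡⟨ sumOver-cong (allCube n) (λ v → collect (g (false ∷ v)) (g (true ∷ v)) (X n v)) ⟩
  Σ[cube] n (λ v → (g (false ∷ v) + g (false ∷ v)) * X n v)
    ≡⟨ Σ[cube]-χ-sift n (λ v → g (false ∷ v) + g (false ∷ v)) ⟩
  Σ[cube] n (λ _ → g (zeros (suc n)) + g (zeros (suc n)))
    ≡⟨ sym (Σ[cube]-suc n _) ⟩
  Σ[cube] (suc n) (λ _ → g (zeros (suc n))) ∎
  where
  X : ∀ m → Cube m → ℚ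
  X m w = Σ[cube] m (λ α → χ α w)

  X-false : ∀ v → X (suc n) (false ∷ v) ≡ X n v + X n v
  X-false v = trans (Σ[cube]-suc n _) (sumOver-+ (allCube n) _ _)

  X-true : ∀ v → X (suc n) (true ∷ v) ≡ 0ℚ
  X-true v = begin
    X (suc n) (true ∷ v)
      ≡⟨ Σ[cube]-suc n _ ⟩
    Σ[cube] n (λ α → sgn (inner α v) + sgn (not (inner α v)))
      ≡⟨ sumOver-cong (allCube n) (λ α → sgn-not (inner α v)) ⟩
    Σ[cube] n (λ _ → 0ℚ)
      ≡⟨ sumOver-zero (allCube n) ⟩
    0ℚ ∎

  collect : ∀ a b x → a * (x + x) + b * 0ℚ ≡ (a + a) * x
  collect a b x = begin
    a * (x + x) + b * 0ℚ  ≡⟨ cong (a * (x + x) +_) (*-zeroʳ b) ⟩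
    a * (x + x) + 0ℚ      ≡⟨ +-identityʳ _ ⟩
    a * (x + x)           ≡⟨ *-distribˡ-+ a x x ⟩
    a * x + a * x         ≡⟨ sym (*-distribʳ-+ x a a) ⟩
    (a + a) * x           ∎

𝔼-χ-sift : ∀ (g : Cube n → ℚ) v → 𝔼 n (λ w → g w * Σ[cube] n (λ α → χ α (w ⊕ v))) ≡ g v
𝔼-χ-sift {n} g v = begin
  𝔼 n (λ w → g w * X (w ⊕ v))               ≡⟨ sym (𝔼-translate v _) ⟩
  𝔼 n (λ w → g (w ⊕ v) * X ((w ⊕ v) ⊕ v))   ≡⟨ 𝔼-cong (λ w → cong (λ z → g (w ⊕ v) * X z)
                                                                 (⊕-cancelʳ w v)) ⟩
  𝔼 n (λ w → g (w ⊕ v) * X w)               ≡⟨ cong (_* _) (Σ[cube]-χ-sift n (λ w → g (w ⊕ v))) ⟩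
  𝔼 n (λ _ → g (zeros n ⊕ v))               ≡⟨ 𝔼-const n _ ⟩
  g (zeros n ⊕ v)                           ≡⟨ cong g (⊕-identityˡ v) ⟩
  g v                                       ∎
  where
  X : Cube n → ℚ
  X w = Σ[cube] n (λ α → χ α w)

parseval : ∀ (a b : Cube n → ℚ) → Σ[cube] n (λ α → fourier a α * fourier b α) ≡ 𝔼 n (λ w → a w * b w)
parseval {n} a b = begin
  Σ[cube] n (λ α → fourier a α * fourier b α)
    ≡⟨ sumOver-cong (allCube n) (λ α → 𝔼-product (λ u → a u * χ α u) (λ v → b v * χ α v)) ⟩
  Σ[cube] n (λ α → 𝔼 n (λ u → 𝔼 n (λ v → (a u * χ α u) * (b v * χ α v))))
    ≡⟨ Σ[cube]-𝔼-comm n (λ α u → 𝔼 n (λ v → (a u * χ α u) * (b v * χ α v))) ⟩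
  𝔼 n (λ u → Σ[cube] n (λ α → 𝔼 n (λ v → (a u * χ α u) * (b v * χ α v))))
    ≡⟨ 𝔼-cong (λ u → Σ[cube]-𝔼-comm n (λ α v → (a u * χ α u) * (b v * χ α v))) ⟩
  𝔼 n (λ u → 𝔼 n (λ v → Σ[cube] n (λ α → (a u * χ α u) * (b v * χ α v))))
    ≡⟨ 𝔼-cong (λ u → 𝔼-cong (λ v → collect u v)) ⟩
  𝔼 n (λ u → 𝔼 n (λ v → a u * (b v * Σ[cube] n (λ α → χ α (v ⊕ u)))))
    ≡⟨ 𝔼-cong (λ u → 𝔼-*ˡ {n} (a u) _) ⟩
  𝔼 n (λ u → a u * 𝔼 n (λ v → b v * Σ[cube] n (λ α → χ α (v ⊕ u))))
    ≡⟨ 𝔼-cong (λ u → cong (a u *_) (𝔼-χ-sift b u)) ⟩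
  𝔼 n (λ u → a u * b u) ∎
  where
  rearrange : ∀ x p y q → (x * p) * (y * q) ≡ x * (y * (q * p))
  rearrange = solve-∀ ℚ-ring

  collect : ∀ u v → Σ[cube] n (λ α → (a u * χ α u) * (b v * χ α v))
                    ≡ a u * (b v * Σ[cube] n (λ α → χ α (v ⊕ u)))
  collect u v = begin
    Σ[cube] n (λ α → (a u * χ α u) * (b v * χ α v))
      ≡⟨ sumOver-cong (allCube n) (λ α → trans (rearrange (a u) (χ α u) (b v) (χ α v))
                                               (cong (λ z → a u * (b v * z)) (sym (χ-⊕ʳ α v u)))) ⟩
    Σ[cube] n (λ α → a u * (b v * χ α (v ⊕ u)))
      ≡⟨ sumOver-*ˡ (allCube n) (a u) _ ⟩
    a u * Σ[cube] n (λ α → b v * χ α (v ⊕ u))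
      ≡⟨ cong (a u *_) (sumOver-*ˡ (allCube n) (b v) _) ⟩
    a u * (b v * Σ[cube] n (λ α → χ α (v ⊕ u))) ∎

fourier-⊕ : ∀ (b : Cube n → ℚ) α β → fourier b (α ⊕ β) ≡ fourier (λ w → b w * χ α w) β
fourier-⊕ b α β = 𝔼-cong (λ w → trans (cong (b w *_) (χ-⊕ˡ α β w)) (sym (*-assoc (b w) _ _)))

fourier-* : ∀ (a b : Cube n → ℚ) α →
            fourier (λ w → a w * b w) α ≡ Σ[cube] n (λ β → fourier a β * fourier b (α ⊕ β))
fourier-* {n} a b α = sym (begin
  Σ[cube] n (λ β → fourier a β * fourier b (α ⊕ β))
    ≡⟨ sumOver-cong (allCube n) (λ β → cong (fourier a β *_) (fourier-⊕ b α β)) ⟩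
  Σ[cube] n (λ β → fourier a β * fourier (λ w → b w * χ α w) β)
    ≡⟨ parseval a _ ⟩
  𝔼 n (λ w → a w * (b w * χ α w))
    ≡⟨ 𝔼-cong (λ w → sym (*-assoc (a w) _ _)) ⟩
  fourier (λ w → a w * b w) α ∎)

_⋆_ : (a b : Cube n → ℚ) → Cube n → ℚ
_⋆_ {n} a b w = 𝔼 n (λ u → a u * b (w ⊕ u))

fourier-⋆ : ∀ (a b : Cube n → ℚ) α → fourier (a ⋆ b) α ≡ fourier a α * fourier b α
fourier-⋆ {n} a b α = sym (begin
  fourier a α * fourier b α
    ≡⟨ 𝔼-product (λ u → a u * χ α u) (λ v → b v * χ α v) ⟩
  𝔼 n (λ u → 𝔼 n (λ v → (a u * χ α u) * (b v * χ α v)))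
    ≡⟨ 𝔼-cong (λ u → sym (𝔼-translate u (λ v → (a u * χ α u) * (b v * χ α v)))) ⟩
  𝔼 n (λ u → 𝔼 n (λ w → (a u * χ α u) * (b (w ⊕ u) * χ α (w ⊕ u))))
    ≡⟨ 𝔼-cong (λ u → 𝔼-cong (λ w → cancel u w)) ⟩
  𝔼 n (λ u → 𝔼 n (λ w → (a u * b (w ⊕ u)) * χ α w))
    ≡⟨ 𝔼-swap (λ u w → (a u * b (w ⊕ u)) * χ α w) ⟩
  𝔼 n (λ w → 𝔼 n (λ u → (a u * b (w ⊕ u)) * χ α w))
    ≡⟨ 𝔼-cong (λ w → 𝔼-*ʳ (χ α w) (λ u → a u * b (w ⊕ u))) ⟩
  fourier (a ⋆ b) α ∎)
  where
  rearrange : ∀ x p y q → (x * p) * (y * (q * p)) ≡ ((x * y) * q) * (p * p)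
  rearrange = solve-∀ ℚ-ring

  cancel : ∀ u w → (a u * χ α u) * (b (w ⊕ u) * χ α (w ⊕ u)) ≡ (a u * b (w ⊕ u)) * χ α w
  cancel u w = begin
    (a u * χ α u) * (b (w ⊕ u) * χ α (w ⊕ u))
      ≡⟨ cong (λ z → (a u * χ α u) * (b (w ⊕ u) * z)) (χ-⊕ʳ α w u) ⟩
    (a u * χ α u) * (b (w ⊕ u) * (χ α w * χ α u))
      ≡⟨ rearrange (a u) (χ α u) (b (w ⊕ u)) (χ α w) ⟩
    ((a u * b (w ⊕ u)) * χ α w) * (χ α u * χ α u)
      ≡⟨ cong (((a u * b (w ⊕ u)) * χ α w) *_) (sgn-square (inner α u)) ⟩
    ((a u * b (w ⊕ u)) * χ α w) * 1ℚ
      ≡⟨ *-identityʳ _ ⟩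
    (a u * b (w ⊕ u)) * χ α w ∎

autocorr : (Cube n → ℚ) → Cube n → ℚ
autocorr h = h ⋆ h

fourier-square : ∀ (h : Cube n → ℚ) α → fourier h α ^ℚ 2 ≡ fourier (autocorr h) α
fourier-square h α = trans (cong (fourier h α *_) (*-identityʳ _)) (sym (fourier-⋆ h h α))

Σ[cube]-fourier-additive-triples : ∀ (a b c : Cube n → ℚ) →
  Σ[cube] n (λ α → Σ[cube] n (λ β → (fourier a α * fourier b β) * fourier c (α ⊕ β)))
    ≡ 𝔼 n (λ w → a w * (b w * c w))
Σ[cube]-fourier-additive-triples {n} a b c = begin
  Σ[cube] n (λ α → Σ[cube] n (λ β → (fourier a α * fourier b β) * fourier c (α ⊕ β)))
    ≡⟨ sumOver-cong (allCube n) (λ α → trans (sumOver-cong (allCube n) (λ β → *-assoc (fourier a α) _ _))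
                                             (sumOver-*ˡ (allCube n) (fourier a α) _)) ⟩
  Σ[cube] n (λ α → fourier a α * Σ[cube] n (λ β → fourier b β * fourier c (α ⊕ β)))
    ≡⟨ sumOver-cong (allCube n) (λ α → cong (fourier a α *_) (sym (fourier-* b c α))) ⟩
  Σ[cube] n (λ α → fourier a α * fourier (λ w → b w * c w) α)
    ≡⟨ parseval a _ ⟩
  𝔼 n (λ w → a w * (b w * c w)) ∎

Σ[cube]-fourier-triple-product : ∀ (a b c : Cube n → ℚ) →
  Σ[cube] n (λ α → fourier a α * (fourier b α * fourier c α)) ≡ 𝔼 n (λ w → a w * (b ⋆ c) w)
Σ[cube]-fourier-triple-product {n} a b c =
  trans (sumOver-cong (allCube n) (λ α → cong (fourier a α *_) (sym (fourier-⋆ b c α))))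
        (parseval a (b ⋆ c))

autocorr-deriv-sym : ∀ (f : Cube n → ℚ) x w → autocorr (deriv f x) w ≡ autocorr (deriv f w) x
autocorr-deriv-sym f x w = 𝔼-cong (λ u → begin
  (f u * f (u ⊕ x)) * (f (w ⊕ u) * f ((w ⊕ u) ⊕ x))
    ≡⟨ *-interchange (f u) _ _ _ ⟩
  (f u * f (w ⊕ u)) * (f (u ⊕ x) * f ((w ⊕ u) ⊕ x))
    ≡⟨ cong₂ (λ p q → (f u * f p) * (f q * f ((w ⊕ u) ⊕ x))) (⊕-comm w u) (⊕-comm u x) ⟩
  (f u * f (u ⊕ w)) * (f (x ⊕ u) * f ((w ⊕ u) ⊕ x))
    ≡⟨ cong (λ p → (f u * f (u ⊕ w)) * (f (x ⊕ u) * f p)) (swap u) ⟩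
  (f u * f (u ⊕ w)) * (f (x ⊕ u) * f ((x ⊕ u) ⊕ w)) ∎)
  where
  swap : ∀ u → (w ⊕ u) ⊕ x ≡ (x ⊕ u) ⊕ w
  swap u = begin
    (w ⊕ u) ⊕ x  ≡⟨ ⊕-assoc w u x ⟩
    w ⊕ (u ⊕ x)  ≡⟨ ⊕-comm w _ ⟩
    (u ⊕ x) ⊕ w  ≡⟨ cong (_⊕ w) (⊕-comm u x) ⟩
    (x ⊕ u) ⊕ w  ∎

Σ[cube]-fourier-deriv-additive-triples : ∀ (f : Cube n → ℚ) x y →
  Σ[cube] n (λ α → Σ[cube] n (λ β →
      (fourier (deriv f x) α ^ℚ 2) * (fourier (deriv f y) β ^ℚ 2)
        * (fourier (deriv f (x ⊕ y)) (α ⊕ β) ^ℚ 2)))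
    ≡ 𝔼 n (λ w → autocorr (deriv f x) w * (autocorr (deriv f y) w * autocorr (deriv f (x ⊕ y)) w))
Σ[cube]-fourier-deriv-additive-triples {n} f x y = trans
  (sumOver-cong (allCube n) (λ α → sumOver-cong (allCube n) (λ β →
    cong₂ _*_ (cong₂ _*_ (fourier-square (deriv f x) α) (fourier-square (deriv f y) β))
              (fourier-square (deriv f (x ⊕ y)) (α ⊕ β)))))
  (Σ[cube]-fourier-additive-triples
    (autocorr (deriv f x)) (autocorr (deriv f y)) (autocorr (deriv f (x ⊕ y))))

Σ[cube]-fourier-deriv-sixth-powers : ∀ (f : Cube n → ℚ) y →
  Σ[cube] n (λ α → fourier (deriv f y) α ^ℚ 6)
    ≡ 𝔼 n (λ w → autocorr (deriv f y) w * autocorr (autocorr (deriv f y)) w)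
Σ[cube]-fourier-deriv-sixth-powers {n} f y = trans
  (sumOver-cong (allCube n) (λ α → trans (cube-of-square (fourier (deriv f y) α))
    (cong (λ z → z * (z * z)) (fourier-square (deriv f y) α))))
  (Σ[cube]-fourier-triple-product (autocorr (deriv f y)) (autocorr (deriv f y)) (autocorr (deriv f y)))
  where
  -- stated with ^ℚ unfolded, which the ring solver does not see through
  cube-of-square : ∀ z → z * (z * (z * (z * (z * (z * 1ℚ)))))
                           ≡ (z * (z * 1ℚ)) * ((z * (z * 1ℚ)) * (z * (z * 1ℚ)))
  cube-of-square = solve-∀ ℚ-ring

lemma6p5 : (n : ℕ) (f : Cube n → ℚ) → IsBoolean f →
    𝔼 n (λ x → 𝔼 n (λ y → Σ[cube] n (λ α → Σ[cube] n (λ β →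
        (fourier (deriv f x) α ^ℚ 2) * (fourier (deriv f y) β ^ℚ 2)
          * (fourier (deriv f (x ⊕ y)) (α ⊕ β) ^ℚ 2)))))
      ≡ 𝔼 n (λ y → Σ[cube] n (λ α → fourier (deriv f y) α ^ℚ 6))
lemma6p5 n f _ = begin
  𝔼 n (λ x → 𝔼 n (λ y → Σ[cube] n (λ α → Σ[cube] n (λ β →
      (fourier (deriv f x) α ^ℚ 2) * (fourier (deriv f y) β ^ℚ 2)
        * (fourier (deriv f (x ⊕ y)) (α ⊕ β) ^ℚ 2)))))
    ≡⟨ 𝔼-cong (λ x → 𝔼-cong (λ y → Σ[cube]-fourier-deriv-additive-triples f x y)) ⟩
  𝔼 n (λ x → 𝔼 n (λ y → 𝔼 n (λ w → K x w * (K y w * K (x ⊕ y) w))))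
    ≡⟨ 𝔼-cong (λ x → 𝔼-cong (λ y → 𝔼-cong (λ w →
         cong₂ _*_ (K-sym x w) (cong₂ _*_ (K-sym y w) (K-sym (x ⊕ y) w))))) ⟩
  𝔼 n (λ x → 𝔼 n (λ y → 𝔼 n (λ w → K w x * (K w y * K w (x ⊕ y)))))
    ≡⟨ 𝔼-cong (λ x → 𝔼-swap (λ y w → K w x * (K w y * K w (x ⊕ y)))) ⟩
  𝔼 n (λ x → 𝔼 n (λ w → 𝔼 n (λ y → K w x * (K w y * K w (x ⊕ y)))))
    ≡⟨ 𝔼-swap (λ x w → 𝔼 n (λ y → K w x * (K w y * K w (x ⊕ y)))) ⟩
  𝔼 n (λ w → 𝔼 n (λ x → 𝔼 n (λ y → K w x * (K w y * K w (x ⊕ y)))))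
    ≡⟨ 𝔼-cong (λ w → 𝔼-cong (λ x → 𝔼-*ˡ (K w x) (λ y → K w y * K w (x ⊕ y)))) ⟩
  𝔼 n (λ w → 𝔼 n (λ x → K w x * autocorr (K w) x))
    ≡⟨ 𝔼-cong (λ w → sym (Σ[cube]-fourier-deriv-sixth-powers f w)) ⟩
  𝔼 n (λ y → Σ[cube] n (λ α → fourier (deriv f y) α ^ℚ 6)) ∎
  where
  K : Cube n → Cube n → ℚ
  K x = autocorr (deriv f x)

  K-sym : ∀ x w → K x w ≡ K w x
  K-sym = autocorr-deriv-sym f
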